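{- Let $n\ge1$, $h\ge1$, $0\le\bar w\le n$, let $H$ be a multiset of $h$ binary strings each of length $n$ and weight $\bar w$, and let $M=M(H)$. Let $f,f'$ be two cumulative weight functions that are solutions to $M$, let $m\in[2h]$, and let $[l_1,l_2]\subset[n]$. If there is no branching point in $\mathcal{G}(f_m,[l_1,l_2])$ and $f_m(l_2)=f'_{m'}(l_2)$ for some $m'\in[2h]$, then $f_m(l)=f'_{m'}(l)$ for all $l\in[l_1-1,l_2]$.
   Context: Notation: $[n]=\{1,\dots,n\}$; $[n_1,n_2]=\{n_1,\dots,n_2\}$ if $n_1\le n_2$, else $\emptyset$. For a binary string $t$ of length $n$, $\mathrm{wt}(t)$ is its number of ones, $t[l]$, $t[-l]$ its length-$l$ prefix and suffix; $M(t)$ is the multiset union of $\{(j-\mathrm{wt}(t[j]),\mathrm{wt}(t[j])) : j\in[n]\}$ and $\{(j-\mathrm{wt}(t[-j]),\mathrm{wt}(t[-j])) : j\in[n]\}$, and $M(H)$ is the multiset union of $M(t)$, $t\in H$. A cumulative weight function (CWF) is $f:\{0,\dots,n\}\times[2h]\to\{0,\dots,n\}$ with (a) $f(0,m)=0$; (b) $f(l,m)-f(l-1,m)\in\{0,1\}$ for $(l,m)\in[n]\times[2h]$; (c) for each $j\in[h]$ there is $w_j$ with $f(l,2j-1)+f(n-l,2j)=w_j$ for all $l\in\{0,\dots,n\}$. Write $f_m(l)=f(l,m)$. $f$ is a solution to $M$ if $M=\{(l-f_m(l),f_m(l)): m\in[2h],l\in[n]\}$ as multisets. For $I\subset\{0,\dots,n\}$,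 $\mathcal{G}(f_m,I)=\{(l,f_m(l)):l\in I\}$. With $A(l,w)=\{m\in[2h]: f_m(l)=w\}$ (computed for the solution $f$), set for $(l,w)\in[n]^2$: $b_{l,w}=|A(l,w)\cap A(l-1,w)|$, $c_{l,w}=|A(l,w)\cap A(l-1,w-1)|$, and $b_{l,0}=|A(l,0)|$, $c_{l,0}=0$ for $l\in[n]$. A point $(l,w)\in\{0,\dots,n\}^2$ is a branching point if $b_{l,w}>0$ and $c_{l,w}>0$. -}

module Defs where

open import Data.Nat using (ℕ; zero; suc; _+_; _*_; _∸_; _≤_; _<_; _≟_)
open import Data.Bool using (Bool; true; false)
open import Data.List using (List; []; _∷_; map; concatMap; upTo; take; drop; length; filter; _++_)
open import Data.Product using (_×_; _,_; ∃)
open import Data.Sum using (_⊎_)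
open import Relation.Nullary.Decidable using (_×-dec_)
open import Relation.Binary.PropositionalEquality using (_≡_)
open import Data.List.Relation.Binary.Permutation.Propositional using (_↭_)

[1⋯_] : ℕ → List ℕ
[1⋯ a ] = map suc (upTo a)

wt : List Bool → ℕ
wt [] = 0
wt (true ∷ t) = suc (wt t)
wt (false ∷ t) = wt t

-- M(t) for a binary string t of length n (prefixes t[j] = take j t,
-- suffixes t[-j] = drop (n ∸ j) t), as a list (multiset)
Mstr : ℕ → List Bool → List (ℕ × ℕ)
Mstr n t =
  map (λ j → (j ∸ wt (take j t) , wt (take j t))) [1⋯ n ]
  ++ map (λ j → (j ∸ wt (drop (n ∸ j) t) , wt (drop (n ∸ j) t))) [1⋯ n ]

MH : ℕ → List (List Bool) → List (ℕ × ℕ)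
MH n H = concatMap (Mstr n) H

-- A cumulative weight function f : {0..n} × [2h] → {0..n}, written f l m = f(l,m) = f_m(l).
-- (Values outside the domain are irrelevant.)
record IsCWF (n h : ℕ) (f : ℕ → ℕ → ℕ) : Set where
  field
    codom : ∀ l m → l ≤ n → 1 ≤ m → m ≤ 2 * h → f l m ≤ n
    cwf-a : ∀ m → 1 ≤ m → m ≤ 2 * h → f 0 m ≡ 0
    cwf-b : ∀ l m → 1 ≤ l → l ≤ n → 1 ≤ m → m ≤ 2 * h →
            (f l m ≡ f (l ∸ 1) m) ⊎ (f l m ≡ suc (f (l ∸ 1) m))
    cwf-c : ∀ j → 1 ≤ j → j ≤ h →
            ∃ λ w → ∀ l → l ≤ n → f l (2 * j ∸ 1) + f (n ∸ l) (2 * j) ≡ w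

Mf : ℕ → ℕ → (ℕ → ℕ → ℕ) → List (ℕ × ℕ)
Mf n h f = concatMap (λ m → map (λ l → (l ∸ f l m , f l m)) [1⋯ n ]) [1⋯ 2 * h ]

-- f is a solution to M (equality as multisets = permutation of lists)
IsSolution : ℕ → ℕ → List (ℕ × ℕ) → (ℕ → ℕ → ℕ) → Set
IsSolution n h M f = M ↭ Mf n h f

bcoef : ℕ → (ℕ → ℕ → ℕ) → ℕ → ℕ → ℕ
bcoef h f l zero = length (filter (λ m → f l m ≟ 0) [1⋯ 2 * h ])
bcoef h f l (suc w) =
  length (filter (λ m → (f l m ≟ suc w) ×-dec (f (l ∸ 1) m ≟ suc w)) [1⋯ 2 * h ])

ccoef : ℕ → (ℕ → ℕ → ℕ) → ℕ → ℕ → ℕ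
ccoef h f l zero = 0
ccoef h f l (suc w) =
  length (filter (λ m → (f l m ≟ suc w) ×-dec (f (l ∸ 1) m ≟ w)) [1⋯ 2 * h ])

IsBranching : ℕ → (ℕ → ℕ → ℕ) → ℕ → ℕ → Set
IsBranching h f l w = (0 < bcoef h f l w) × (0 < ccoef h f l w)

{-# OPTIONS --safe #-}
-- Two solutions f, f' of the same multiset M have, at every l, the same number of indices m
-- with f_m(l) ≥ w: these are the points (a , b) of M with a + b = l and b ≥ w.  Since every
-- f_m rises by 0 or 1 from l - 1 to l, b_{l,w} and c_{l,w} are differences of such counts,
-- so they too are the same for f and f'.  If f_m and f'_{m'} meet at (l , w) while one of
-- them is flat and the other rises on [l - 1 , l], then b_{l,w} > 0 and c_{l,w} > 0, so
-- (l , w) is a branching point.  Away from branching points, agreement at l therefore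
-- propagates to l - 1, and the claim follows by descending induction from l₂.
module Submission where

open import Defs
open import Level using (Level)
open import Data.Nat using (ℕ; zero; suc; _+_; _*_; _∸_; _≤_; _<_; _≟_; _≤?_; z≤n; s≤s)
open import Data.Nat.Properties
  using (suc-injective; ≤-trans; ≤-reflexive; <⇒≤; <-irrefl; n≤1+n; m≤n+m; m∸n≤m; m∸n+n≡m;
         m≤n⇒m<n∨m≡n; m≤n⇒m≤1+n; ≤-pred; +-suc; +-cancelˡ-≡)
open import Data.Bool using (Bool; true; false)
open import Data.List using (List; []; _∷_; _++_; [_]; length; map; filter; concatMap)
open import Data.List.Properties using (filter-++; length-++; filter-some; filter-none; filter-accept; filter-reject)
open import Data.List.Relation.Unary.All as All using (All; []; _∷_)
open import Data.List.Relation.Unary.Any using (here; there)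
open import Data.List.Relation.Unary.Unique.Propositional using (Unique; _∷_)
import Data.List.Relation.Unary.Unique.Propositional.Properties as Unique
open import Data.List.Membership.Propositional using (_∈_; lose)
open import Data.List.Membership.Propositional.Properties using (∈-map⁺; ∈-map⁻; ∈-upTo⁺; ∈-upTo⁻)
open import Data.List.Relation.Binary.Permutation.Propositional using (_↭_; ↭-sym; ↭-trans)
open import Data.List.Relation.Binary.Permutation.Propositional.Properties using (filter-↭; ↭-length)
open import Data.Product using (_×_; _,_; proj₁; proj₂)
open import Data.Sum using (_⊎_; inj₁; inj₂; [_,_]′)
open import Function using (id; _∘_; _⇔_; mk⇔; Equivalence)
open import Relation.Nullary using (¬_; Dec; yes; no; does; contradiction)
open import Relation.Nullary.Decidable using (_×-dec_)
open import Relation.Unary using (Pred; Decidable)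
open import Relation.Binary using (DecidableEquality)
open import Relation.Binary.PropositionalEquality
  using (_≡_; refl; sym; trans; cong; cong₂; subst; module ≡-Reasoning)

private variable
  a p q r : Level
  A B : Set a

count : {P : Pred A p} → Decidable P → List A → ℕ
count P? xs = length (filter P? xs)

module _ {P : Pred A p} (P? : Decidable P) where

  count-++ : ∀ xs ys → count P? (xs ++ ys) ≡ count P? xs + count P? ys
  count-++ xs ys = trans (cong length (filter-++ P? xs ys)) (length-++ (filter P? xs))

  count-↭ : ∀ {xs ys} → xs ↭ ys → count P? xs ≡ count P? ys
  count-↭ xs↭ys = ↭-length (filter-↭ P? xs↭ys)

  count-map : (g : B → A) → ∀ xs → count P? (map g xs) ≡ count (P? ∘ g) xs
  count-map g [] = refl
  count-map g (x ∷ xs) with does (P? (g x))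
  ... | true  = cong suc (count-map g xs)
  ... | false = count-map g xs

  count-pos : ∀ {x xs} → x ∈ xs → P x → 0 < count P? xs
  count-pos x∈xs px = filter-some P? (lose x∈xs px)

  count-singleton : ∀ {x} → P x → count P? [ x ] ≡ 1
  count-singleton px = cong length (filter-accept P? px)

  count-none : ∀ {xs} → All (¬_ ∘ P) xs → count P? xs ≡ 0
  count-none none = cong length (filter-none P? none)

module _ {P : Pred A p} {Q : Pred A q} (P? : Decidable P) (Q? : Decidable Q) where

  count-cong : ∀ {xs} → All (λ x → P x ⇔ Q x) xs → count P? xs ≡ count Q? xs
  count-cong [] = refl
  count-cong {x ∷ xs} (P⇔Q ∷ P⇔Qs) with P? x | Q? x
  ... | yes _  | yes _  = cong suc (count-cong P⇔Qs)
  ... | no _   | no _   = count-cong P⇔Qs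
  ... | yes px | no ¬qx = contradiction (Equivalence.to P⇔Q px) ¬qx
  ... | no ¬px | yes qx = contradiction (Equivalence.from P⇔Q qx) ¬px

count-concatMap : {P : Pred A p} {Q : Pred B q} (P? : Decidable P) (Q? : Decidable Q)
                  (F : A → List B) → ∀ {xs} → All (λ x → count Q? (F x) ≡ count P? [ x ]) xs →
                  count Q? (concatMap F xs) ≡ count P? xs
count-concatMap P? Q? F [] = refl
count-concatMap P? Q? F {x ∷ xs} (eq ∷ eqs) = begin
  count Q? (F x ++ concatMap F xs)          ≡⟨ count-++ Q? (F x) (concatMap F xs) ⟩
  count Q? (F x) + count Q? (concatMap F xs) ≡⟨ cong₂ _+_ eq (count-concatMap P? Q? F eqs) ⟩
  count P? [ x ] + count P? xs               ≡⟨ count-++ P? [ x ] xs ⟨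
  count P? (x ∷ xs)                          ∎
  where open ≡-Reasoning

module _ {P : Pred A p} {Q : Pred A q} {R : Pred A r}
         (P? : Decidable P) (Q? : Decidable Q) (R? : Decidable R) where

  count-⊎ : ∀ {xs} → All (λ x → (P x ⇔ (Q x ⊎ R x)) × ¬ (Q x × R x)) xs →
            count P? xs ≡ count Q? xs + count R? xs
  count-⊎ [] = refl
  count-⊎ {x ∷ xs} ((P⇔Q⊎R , disjoint) ∷ hyps) with P? x | Q? x | R? x
  ... | _      | yes qx | yes rx = contradiction (qx , rx) disjoint
  ... | yes _  | yes _  | no _   = cong suc (count-⊎ hyps)
  ... | yes _  | no _   | yes _  = trans (cong suc (count-⊎ hyps)) (sym (+-suc _ _))
  ... | no _   | no _   | no _   = count-⊎ hyps
  ... | yes px | no ¬qx | no ¬rx = contradiction (Equivalence.to P⇔Q⊎R px) [ ¬qx , ¬rx ]′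
  ... | no ¬px | yes qx | no _   = contradiction (Equivalence.from P⇔Q⊎R (inj₁ qx)) ¬px
  ... | no ¬px | no _   | yes rx = contradiction (Equivalence.from P⇔Q⊎R (inj₂ rx)) ¬px

module _ (_≟ᴬ_ : DecidableEquality A) where

  count-≟-unique : ∀ {x xs} → Unique xs → x ∈ xs → count (_≟ᴬ x) xs ≡ 1
  count-≟-unique {x} (x∉xs ∷ _) (here refl) =
    cong length (trans (filter-accept (_≟ᴬ x) refl)
                       (cong (x ∷_) (filter-none (_≟ᴬ x) (All.map (λ x≢y y≡x → x≢y (sym y≡x)) x∉xs))))
  count-≟-unique {x} (y∉ys ∷ unique) (there x∈ys) =
    trans (cong length (filter-reject (_≟ᴬ x) (All.lookup y∉ys x∈ys))) (count-≟-unique unique x∈ys)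

∈-[1⋯]⁻ : ∀ {k m} → m ∈ [1⋯ k ] → 1 ≤ m × m ≤ k
∈-[1⋯]⁻ m∈ with ∈-map⁻ suc m∈
... | _ , i∈ , refl = s≤s z≤n , ∈-upTo⁻ i∈

∈-[1⋯]⁺ : ∀ {k m} → 1 ≤ m → m ≤ k → m ∈ [1⋯ k ]
∈-[1⋯]⁺ {m = suc i} _ m≤k = ∈-map⁺ suc (∈-upTo⁺ m≤k)

[1⋯]-unique : ∀ k → Unique [1⋯ k ]
[1⋯]-unique k = Unique.map⁺ suc-injective (Unique.upTo⁺ k)

m∸1≤n⇒m≤1+n : ∀ {m n} → m ∸ 1 ≤ n → m ≤ suc n
m∸1≤n⇒m≤1+n {zero}  _   = z≤n
m∸1≤n⇒m≤1+n {suc _} m≤n = s≤s m≤n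

downward-induction : (P : ℕ → Set p) {u : ℕ} → P u → (∀ {l} → l < u → P (suc l) → P l) →
                     ∀ {l} → l ≤ u → P l
downward-induction P {u} Pu step {l} l≤u = go (u ∸ l) l (m∸n+n≡m l≤u)
  where
  go : ∀ d l → d + l ≡ u → P l
  go zero    l refl  = Pu
  go (suc d) l d+l≡u = step (≤-trans (s≤s (m≤n+m l d)) (≤-reflexive d+l≡u))
                            (go d (suc l) (trans (+-suc d l) d+l≡u))

-- a and b stand for the values f_m(l - 1) and f_m(l) of a cumulative weight function.
≤-prev-split : ∀ {a b} w → b ≡ a ⊎ b ≡ suc a → w ≤ a ⇔ (suc w ≤ b ⊎ (b ≡ w × a ≡ w))
≤-prev-split w (inj₁ refl) =
  mk⇔ (λ w≤a → [ inj₁ , (λ w≡a → inj₂ (sym w≡a , sym w≡a)) ]′ (m≤n⇒m<n∨m≡n w≤a))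
      [ <⇒≤ , (λ (_ , a≡w) → ≤-reflexive (sym a≡w)) ]′
≤-prev-split w (inj₂ refl) =
  mk⇔ (inj₁ ∘ s≤s) [ ≤-pred , (λ (_ , a≡w) → ≤-reflexive (sym a≡w)) ]′

<-next-split : ∀ {a b} w → b ≡ a ⊎ b ≡ suc a → w < b ⇔ (w < a ⊎ (b ≡ suc w × a ≡ w))
<-next-split w (inj₁ refl) =
  mk⇔ inj₁ [ id , (λ (b≡1+w , _) → ≤-reflexive (sym b≡1+w)) ]′
<-next-split w (inj₂ refl) =
  mk⇔ (λ w<b → [ inj₁ , (λ w≡a → inj₂ (cong suc (sym w≡a) , sym w≡a)) ]′ (m≤n⇒m<n∨m≡n (≤-pred w<b)))
      [ m≤n⇒m≤1+n , (λ (b≡1+w , _) → ≤-reflexive (sym b≡1+w)) ]′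

atLeast : ℕ → (ℕ → ℕ → ℕ) → ℕ → ℕ → ℕ
atLeast h f l w = count (λ m → w ≤? f l m) [1⋯ 2 * h ]

-- M records f_m(l) as the point (l - f_m(l) , f_m(l)), which lies on the antidiagonal a + b = l.
DiagonalAbove : ℕ → ℕ → Pred (ℕ × ℕ) _
DiagonalAbove l w (a , b) = a + b ≡ l × w ≤ b

diagonalAbove? : ∀ l w → Decidable (DiagonalAbove l w)
diagonalAbove? l w (a , b) = (a + b ≟ l) ×-dec (w ≤? b)

module CWF {n h : ℕ} {f : ℕ → ℕ → ℕ} (cwf : IsCWF n h f) where
  open IsCWF cwf

  rise : ∀ {l m} → 1 ≤ l → l ≤ n → m ∈ [1⋯ 2 * h ] → f l m ≡ f (l ∸ 1) m ⊎ f l m ≡ suc (f (l ∸ 1) m)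
  rise 1≤l l≤n m∈ = let 1≤m , m≤2h = ∈-[1⋯]⁻ m∈ in cwf-b _ _ 1≤l l≤n 1≤m m≤2h

  f≤l : ∀ {l m} → l ≤ n → m ∈ [1⋯ 2 * h ] → f l m ≤ l
  f≤l {zero}  _   m∈ = let 1≤m , m≤2h = ∈-[1⋯]⁻ m∈ in ≤-reflexive (cwf-a _ 1≤m m≤2h)
  f≤l {suc l} l<n m∈ with rise (s≤s z≤n) l<n m∈
  ... | inj₁ flat = ≤-trans (≤-reflexive flat) (m≤n⇒m≤1+n (f≤l (<⇒≤ l<n) m∈))
  ... | inj₂ up   = ≤-trans (≤-reflexive up) (s≤s (f≤l (<⇒≤ l<n) m∈))

  point : ℕ → ℕ → ℕ × ℕ
  point m l = l ∸ f l m , f l m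

  position : ∀ {l m} → l ≤ n → m ∈ [1⋯ 2 * h ] → l ∸ f l m + f l m ≡ l
  position l≤n m∈ = m∸n+n≡m (f≤l l≤n m∈)

  diagonal-row : ∀ {l m} w → 1 ≤ l → l ≤ n → m ∈ [1⋯ 2 * h ] →
                 count (diagonalAbove? l w) (map (point m) [1⋯ n ]) ≡
                 count (λ m → w ≤? f l m) [ m ]
  diagonal-row {l} {m} w 1≤l l≤n m∈ =
    trans (count-map (diagonalAbove? l w) (point m) [1⋯ n ]) (by-height (w ≤? f l m))
    where
    on-diagonal : ∀ {l′} → l′ ∈ [1⋯ n ] → l′ ∸ f l′ m + f l′ m ≡ l → l′ ≡ l
    on-diagonal l′∈ = trans (sym (position (∈-[1⋯]⁻ l′∈ .proj₂) m∈))

    by-height : Dec (w ≤ f l m) →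
                count (diagonalAbove? l w ∘ point m) [1⋯ n ] ≡
                count (λ m → w ≤? f l m) [ m ]
    by-height (yes w≤) = begin
      count (diagonalAbove? l w ∘ point m) [1⋯ n ]
        ≡⟨ count-cong (diagonalAbove? l w ∘ point m) (_≟ l) (All.tabulate λ l′∈ →
             mk⇔ (λ (on , _) → on-diagonal l′∈ on) (λ { refl → position l≤n m∈ , w≤ })) ⟩
      count (_≟ l) [1⋯ n ]
        ≡⟨ count-≟-unique _≟_ ([1⋯]-unique n) (∈-[1⋯]⁺ 1≤l l≤n) ⟩
      1
        ≡⟨ count-singleton (λ m → w ≤? f l m) w≤ ⟨
      count (λ m → w ≤? f l m) [ m ] ∎
      where open ≡-Reasoning
    by-height (no w≰) = trans
      (count-none (diagonalAbove? l w ∘ point m) (All.tabulate λ l′∈ (on , w≤) →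
        w≰ (subst (λ k → w ≤ f k m) (on-diagonal l′∈ on) w≤)))
      (sym (count-none (λ m → w ≤? f l m) (w≰ ∷ [])))

  atLeast-Mf : ∀ {l} w → 1 ≤ l → l ≤ n → count (diagonalAbove? l w) (Mf n h f) ≡ atLeast h f l w
  atLeast-Mf {l} w 1≤l l≤n = count-concatMap (λ m → w ≤? f l m) (diagonalAbove? l w)
    (λ m → map (point m) [1⋯ n ]) (All.tabulate (diagonal-row w 1≤l l≤n))

  atLeast-prev : ∀ {l} w → 1 ≤ l → l ≤ n →
                 atLeast h f (l ∸ 1) (suc w) ≡ atLeast h f l (suc (suc w)) + bcoef h f l (suc w)
  atLeast-prev {l} w 1≤l l≤n = count-⊎
    (λ m → suc w ≤? f (l ∸ 1) m) (λ m → suc (suc w) ≤? f l m)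
    (λ m → (f l m ≟ suc w) ×-dec (f (l ∸ 1) m ≟ suc w))
    (All.tabulate λ m∈ → ≤-prev-split (suc w) (rise 1≤l l≤n m∈) ,
                         λ (w<fl , fl≡w , _) → <-irrefl (sym fl≡w) w<fl)

  atLeast-next : ∀ {l} w → 1 ≤ l → l ≤ n →
                 atLeast h f l (suc w) ≡ atLeast h f (l ∸ 1) (suc w) + ccoef h f l (suc w)
  atLeast-next {l} w 1≤l l≤n = count-⊎
    (λ m → suc w ≤? f l m) (λ m → suc w ≤? f (l ∸ 1) m)
    (λ m → (f l m ≟ suc w) ×-dec (f (l ∸ 1) m ≟ w))
    (All.tabulate λ m∈ → <-next-split w (rise 1≤l l≤n m∈) ,
                         λ (w<fl′ , _ , fl′≡w) → <-irrefl (sym fl′≡w) w<fl′)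

module Solutions {n h : ℕ} {f f′ : ℕ → ℕ → ℕ} (cwf : IsCWF n h f) (cwf′ : IsCWF n h f′)
                 (same-M : Mf n h f ↭ Mf n h f′) where
  private
    module F  = CWF cwf
    module F′ = CWF cwf′

  atLeast-≡ : ∀ {l} w → l ≤ n → atLeast h f l w ≡ atLeast h f′ l w
  atLeast-≡ {zero} w _ = count-cong (λ m → w ≤? f 0 m) (λ m → w ≤? f′ 0 m) (All.tabulate λ m∈ →
    let 1≤m , m≤2h = ∈-[1⋯]⁻ m∈
        f₀≡f′₀     = trans (IsCWF.cwf-a cwf _ 1≤m m≤2h) (sym (IsCWF.cwf-a cwf′ _ 1≤m m≤2h))
    in mk⇔ (subst (w ≤_) f₀≡f′₀) (subst (w ≤_) (sym f₀≡f′₀)))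
  atLeast-≡ {suc l} w l<n = begin
    atLeast h f (suc l) w                        ≡⟨ F.atLeast-Mf w (s≤s z≤n) l<n ⟨
    count (diagonalAbove? (suc l) w) (Mf n h f)  ≡⟨ count-↭ (diagonalAbove? (suc l) w) same-M ⟩
    count (diagonalAbove? (suc l) w) (Mf n h f′) ≡⟨ F′.atLeast-Mf w (s≤s z≤n) l<n ⟩
    atLeast h f′ (suc l) w                       ∎
    where open ≡-Reasoning

  ccoef-≡ : ∀ {l} w → 1 ≤ l → l ≤ n → ccoef h f l (suc w) ≡ ccoef h f′ l (suc w)
  ccoef-≡ {l} w 1≤l l≤n = +-cancelˡ-≡ (atLeast h f (l ∸ 1) (suc w)) _ _ (begin
    atLeast h f (l ∸ 1) (suc w) + ccoef h f l (suc w)   ≡⟨ F.atLeast-next w 1≤l l≤n ⟨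
    atLeast h f l (suc w)                               ≡⟨ atLeast-≡ (suc w) l≤n ⟩
    atLeast h f′ l (suc w)                              ≡⟨ F′.atLeast-next w 1≤l l≤n ⟩
    atLeast h f′ (l ∸ 1) (suc w) + ccoef h f′ l (suc w) ≡⟨ cong (_+ _) (atLeast-≡ (suc w) l∸1≤n) ⟨
    atLeast h f (l ∸ 1) (suc w) + ccoef h f′ l (suc w)  ∎)
    where open ≡-Reasoning
          l∸1≤n = ≤-trans (m∸n≤m l 1) l≤n

  bcoef-≡ : ∀ {l} w → 1 ≤ l → l ≤ n → bcoef h f l (suc w) ≡ bcoef h f′ l (suc w)
  bcoef-≡ {l} w 1≤l l≤n = +-cancelˡ-≡ (atLeast h f l (suc (suc w))) _ _ (begin
    atLeast h f l (suc (suc w)) + bcoef h f l (suc w)   ≡⟨ F.atLeast-prev w 1≤l l≤n ⟨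
    atLeast h f (l ∸ 1) (suc w)                         ≡⟨ atLeast-≡ (suc w) l∸1≤n ⟩
    atLeast h f′ (l ∸ 1) (suc w)                        ≡⟨ F′.atLeast-prev w 1≤l l≤n ⟩
    atLeast h f′ l (suc (suc w)) + bcoef h f′ l (suc w) ≡⟨ cong (_+ _) (atLeast-≡ (suc (suc w)) l≤n) ⟨
    atLeast h f l (suc (suc w)) + bcoef h f′ l (suc w)  ∎)
    where open ≡-Reasoning
          l∸1≤n = ≤-trans (m∸n≤m l 1) l≤n

  module _ {l m m′} (1≤l : 1 ≤ l) (l≤n : l ≤ n) (m∈ : m ∈ [1⋯ 2 * h ]) (m′∈ : m′ ∈ [1⋯ 2 * h ])
           (meet : f l m ≡ f′ l m′) where

    flat-meets-rise⇒branching : f l m ≡ f (l ∸ 1) m → f′ l m′ ≡ suc (f′ (l ∸ 1) m′) →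
                                IsBranching h f l (f l m)
    flat-meets-rise⇒branching flat rise′ = subst (IsBranching h f l) (sym fl≡1+w) (b>0 , c>0)
      where
      w = f′ (l ∸ 1) m′
      fl≡1+w = trans meet rise′
      b>0 : 0 < bcoef h f l (suc w)
      b>0 = count-pos (λ k → (f l k ≟ suc w) ×-dec (f (l ∸ 1) k ≟ suc w)) m∈
                      (fl≡1+w , trans (sym flat) fl≡1+w)
      c>0 : 0 < ccoef h f l (suc w)
      c>0 = subst (0 <_) (sym (ccoef-≡ w 1≤l l≤n))
                  (count-pos (λ k → (f′ l k ≟ suc w) ×-dec (f′ (l ∸ 1) k ≟ w)) m′∈ (rise′ , refl))

    rise-meets-flat⇒branching : f l m ≡ suc (f (l ∸ 1) m) → f′ l m′ ≡ f′ (l ∸ 1) m′ →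
                                IsBranching h f l (f l m)
    rise-meets-flat⇒branching rise flat′ = subst (IsBranching h f l) (sym rise) (b>0 , c>0)
      where
      w = f (l ∸ 1) m
      f′l≡1+w = trans (sym meet) rise
      b>0 : 0 < bcoef h f l (suc w)
      b>0 = subst (0 <_) (sym (bcoef-≡ w 1≤l l≤n))
                  (count-pos (λ k → (f′ l k ≟ suc w) ×-dec (f′ (l ∸ 1) k ≟ suc w)) m′∈
                             (f′l≡1+w , trans (sym flat′) f′l≡1+w))
      c>0 : 0 < ccoef h f l (suc w)
      c>0 = count-pos (λ k → (f l k ≟ suc w) ×-dec (f (l ∸ 1) k ≟ w)) m∈ (rise , refl)

    meet-prev : ¬ IsBranching h f l (f l m) → f (l ∸ 1) m ≡ f′ (l ∸ 1) m′
    meet-prev not-branching with F.rise 1≤l l≤n m∈ | F′.rise 1≤l l≤n m′∈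
    ... | inj₁ flat | inj₁ flat′ = trans (sym flat) (trans meet flat′)
    ... | inj₂ rise | inj₂ rise′ = suc-injective (trans (sym rise) (trans meet rise′))
    ... | inj₁ flat | inj₂ rise′ = contradiction (flat-meets-rise⇒branching flat rise′) not-branching
    ... | inj₂ rise | inj₁ flat′ = contradiction (rise-meets-flat⇒branching rise flat′) not-branching

proposition6 : (n h w̄ : ℕ) → 1 ≤ n → 1 ≤ h → w̄ ≤ n →
    (H : List (List Bool)) → length H ≡ h →
    All (λ t → (length t ≡ n) × (wt t ≡ w̄)) H →
    (f f' : ℕ → ℕ → ℕ) →
    IsCWF n h f → IsSolution n h (MH n H) f →
    IsCWF n h f' → IsSolution n h (MH n H) f' →
    (m : ℕ) → 1 ≤ m → m ≤ 2 * h →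
    (l₁ l₂ : ℕ) → (∀ l → l₁ ≤ l → l ≤ l₂ → (1 ≤ l) × (l ≤ n)) →
    (∀ l → l₁ ≤ l → l ≤ l₂ → ¬ IsBranching h f l (f l m)) →
    (m' : ℕ) → 1 ≤ m' → m' ≤ 2 * h → f l₂ m ≡ f' l₂ m' →
    ∀ l → l₁ ∸ 1 ≤ l → l ≤ l₂ → f l m ≡ f' l m'
proposition6 _ _ _ _ _ _ _ _ _ f f' cwf solves cwf' solves' m 1≤m m≤2h l₁ l₂ in-range no-branching
             m' 1≤m' m'≤2h meet-at-l₂ l l₁∸1≤l l≤l₂ =
  downward-induction (λ l → l₁ ∸ 1 ≤ l → f l m ≡ f' l m') (λ _ → meet-at-l₂) meet-below l≤l₂ l₁∸1≤l
  where
  open Solutions cwf cwf' (↭-trans (↭-sym solves) solves')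

  meet-below : ∀ {l} → l < l₂ → (l₁ ∸ 1 ≤ suc l → f (suc l) m ≡ f' (suc l) m') →
               l₁ ∸ 1 ≤ l → f l m ≡ f' l m'
  meet-below {l} l<l₂ meet-above l₁∸1≤l =
    meet-prev 1≤1+l 1+l≤n (∈-[1⋯]⁺ 1≤m m≤2h) (∈-[1⋯]⁺ 1≤m' m'≤2h)
              (meet-above (≤-trans l₁∸1≤l (n≤1+n l))) (no-branching (suc l) l₁≤1+l l<l₂)
    where
    l₁≤1+l = m∸1≤n⇒m≤1+n l₁∸1≤l
    1≤1+l = in-range (suc l) l₁≤1+l l<l₂ .proj₁
    1+l≤n = in-range (suc l) l₁≤1+l l<l₂ .proj₂
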